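{- For any prime $p$ and any system of polynomials $f=(f_1,\dots,f_m)\in\mathbb F_p[x_1,\dots,x_n]^m$, it holds that $|\mathcal V_f|\equiv(-1)^n|\mathcal M_f|\pmod p$.
   Context: $\mathcal V_f=\{x\in\mathbb F_p^n: f_i(x)=0\text{ for all }i\in[m]\}$. The expansion into monic monomials of a polynomial $P\in\mathbb F_p[x]$ writes $P=\sum_\alpha c_\alpha x^\alpha$ with integer representatives $c_\alpha\in\{0,1,\dots,p-1\}$ and lists the monic monomial $x^\alpha$ exactly $c_\alpha$ times, so $P=\sum_{\ell=1}^r t_\ell$. For each $i$ let $\mathrm{CW}_{f_i}=1-f_i^{p-1}$ and let its expansion into monic monomials be $\sum_{\ell=1}^{r_i}t_{i,\ell}$. For $S=(s_1,\dots,s_m)\in[r_1]\times\dots\times[r_m]$, put $t_S=\prod_{i=1}^m t_{i,s_i}$ (a monic monomial of $\mathrm{CW}_f=\prod_i\mathrm{CW}_{f_i}$); $t_S$ is max-degree if $t_S\equiv\prod_{j=1}^n x_j^{p-1}$ modulo the ideal generated by $\{x_j^p-x_j\}_{j\in[n]}$. $\mathcal M_f$ is the set of all such $S$ for which $t_S$ is max-degree. -}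

module Defs where

open import Data.Nat using (ℕ; zero; suc; _+_; _*_; _∸_; _%_; _≡ᵇ_; _^_)

-- reduction to the representative in {0,…,p−1} (p > 0; identity for p = 0, unused)
modP : ℕ → ℕ → ℕ
modP zero x = x
modP (suc k) x = x % suc k

open import Data.Nat.Properties using () renaming (_≟_ to _≟ℕ_)
open import Data.Bool using (Bool; true; false; if_then_else_)
open import Data.Product using (_×_; _,_; proj₁; proj₂; ∃)
open import Data.List using (List; []; _∷_; _++_; map; concatMap; concat; replicate; foldr; upTo; filterᵇ; length; deduplicate; filter)
open import Data.Nat.ListAction using (sum; product)
open import Data.Bool.ListAction using (and)
open import Data.Vec as V using (Vec; toList; zipWith; tabulate; _[_]≔_)
open import Data.Vec.Properties using (≡-dec)
open import Data.Fin using (Fin)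
open import Data.List using (allFin) renaming (tabulate to tabulateL)
open import Relation.Binary.PropositionalEquality using (_≡_)
open import Relation.Nullary.Decidable using (Dec)

Exp : ℕ → Set
Exp n = Vec ℕ n

_≟e_ : ∀ {n} (α β : Exp n) → Dec (α ≡ β)
_≟e_ = ≡-dec _≟ℕ_

-- A polynomial in F_p[x_1..x_n] is given as a formal sum of terms c·x^α,
-- with c a natural-number representative of an element of F_p.
-- (Every element of F_p[x] has such a representation; representations are
--  compared via their coefficients modulo p.)
Poly : ℕ → Set
Poly n = List (ℕ × Exp n)

zeroExp : ∀ {n} → Exp n
zeroExp = V.replicate _ 0

onePoly : ∀ {n} → Poly n
onePoly = (1 , zeroExp) ∷ []

_*P_ : ∀ {n} → Poly n → Poly n → Poly n
P *P Q = concatMap (λ t → map (λ u → (proj₁ t * proj₁ u , zipWith _+_ (proj₂ t) (proj₂ u))) Q) P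

_^P_ : ∀ {n} → Poly n → ℕ → Poly n
P ^P zero = onePoly
P ^P suc k = P *P (P ^P k)

scale : ∀ {n} → ℕ → Poly n → Poly n
scale c = map (λ t → (c * proj₁ t , proj₂ t))

-- P - Q over F_p (−1 is represented by p − 1)
minusP : ∀ {n} (p : ℕ) → Poly n → Poly n → Poly n
minusP p P Q = P ++ scale (p ∸ 1) Q

coeff : ∀ {n} (p : ℕ) → Poly n → Exp n → ℕ
coeff p P α = modP p (sum (map proj₁ (filter (λ t → proj₂ t ≟e α) P)))

PolyEq : ∀ {n} (p : ℕ) → Poly n → Poly n → Set
PolyEq p P Q = ∀ α → coeff p P α ≡ coeff p Q α

monicExpansion : ∀ {n} (p : ℕ) → Poly n → List (Exp n)
monicExpansion p P =
  concatMap (λ α → replicate (coeff p P α) α) (deduplicate _≟e_ (map proj₂ P))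

CW : ∀ {n} (p : ℕ) → Poly n → Poly n
CW p g = minusP p onePoly (g ^P (p ∸ 1))

choices : ∀ {A : Set} → List (List A) → List (List A)
choices [] = [] ∷ []
choices (l ∷ ls) = concatMap (λ a → map (a ∷_) (choices ls)) l

monProd : ∀ {n} → List (Exp n) → Exp n
monProd = foldr (zipWith _+_) zeroExp

-- the list of monomials t_S, one for each S ∈ [r_1] × … × [r_m]
tSs : ∀ {n m} (p : ℕ) → Vec (Poly n) m → List (Exp n)
tSs p fs = map monProd (choices (map (λ f → monicExpansion p (CW p f)) (toList fs)))

mono : ∀ {n} → Exp n → Poly n
mono α = (1 , α) ∷ []

fieldEq : ∀ {n} (p : ℕ) → Fin n → Poly n
fieldEq p j = minusP p (mono (zeroExp [ j ]≔ p)) (mono (zeroExp [ j ]≔ 1))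

CongIdeal : ∀ {n} (p : ℕ) → Poly n → Poly n → Set
CongIdeal {n} p P Q =
  ∃ λ (h : Vec (Poly n) n) →
    PolyEq p (minusP p P Q) (concat (tabulateL (λ j → V.lookup h j *P fieldEq p j)))

IsMaxDeg : ∀ {n} (p : ℕ) → Exp n → Set
IsMaxDeg {n} p t = CongIdeal p (mono t) (mono (V.replicate n (p ∸ 1)))

eval : ∀ {n} (p : ℕ) → Poly n → Vec ℕ n → ℕ
eval p P x = modP p (sum (map (λ t → proj₁ t * product (toList (zipWith _^_ x (proj₂ t)))) P))

points : (p n : ℕ) → List (Vec ℕ n)
points p zero = V.[] ∷ []
points p (suc n) = concatMap (λ a → map (a V.∷_) (points p n)) (upTo p)

numZeros : ∀ {n m} (p : ℕ) → Vec (Poly n) m → ℕ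
numZeros {n} p fs = length (filterᵇ (λ x → and (map (λ f → eval p f x ≡ᵇ 0) (toList fs))) (points p n))

numMaxDeg : ∀ {n m} (p : ℕ) → (Exp n → Bool) → Vec (Poly n) m → ℕ
numMaxDeg p d fs = length (filterᵇ d (tSs p fs))

-- For x ∈ 𝔽ₚⁿ, Fermat's little theorem gives CW_{f_i}(x) = 1 − f_i(x)^{p−1} ≡ [f_i(x) = 0], so
-- |V_f| ≡ ∑_x ∏_i CW_{f_i}(x) = ∑_S ∑_x t_S(x) (mod p). Each inner sum is a product of power sums
-- S_k = ∑_{a ∈ 𝔽ₚ} a^k; from ∑_{j ≤ k} C(k+1, j) S_j = p^{k+1} and periodicity of a^k, S_k ≡ 0
-- unless k is a positive multiple of p − 1, in which case S_k ≡ −1. A monomial whose exponents are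
-- all positive multiples of p − 1 reduces to ∏_j x_j^{p−1} modulo the field equations x_j^p − x_j,
-- and conversely a max-degree monomial agrees with ∏_j x_j^{p−1} on 𝔽ₚⁿ, since the field equations
-- vanish there. Hence ∑_x t_S(x) ≡ (−1)^n for S ∈ M_f and ≡ 0 otherwise.

module Submission where

open import Defs

-- The development works in ℕ; keeping it in an anonymous module leaves the integer operators of
-- the final statement unambiguous.
module _ where

  open import Data.Nat using (ℕ; zero; suc; _+_; _*_; _∸_; _^_; _<_; _≤_; s≤s; z≤n; _%_; _/_; _≡ᵇ_)
  open import Data.Nat.Properties
  open import Data.Nat.DivMod using (%-distribˡ-+; %-distribˡ-*; n%n≡0; m*n%n≡0; m%n%n≡m%n; %-remove-+ˡ; m≡m%n+[m/n]*n; m<n⇒m%n≡m; m%n<n)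
  open import Data.Nat.Divisibility using (_∣_; divides; n∣m⇒m%n≡0)
  open import Data.Nat.Primality using (Prime; euclidsLemma)
  open import Data.Nat.Induction using (<-rec)
  open import Data.Nat.Combinatorics using (_C_; nCk+nC[k+1]≡[n+1]C[k+1]; nCn≡1; nC1≡n; k>n⇒nCk≡0; nCk≡nC[n∸k])
  open import Data.Nat.ListAction using (sum; product)
  open import Data.Nat.ListAction.Properties using (sum-++)
  open import Data.Nat.Solver using (module +-*-Solver)
  open import Algebra.Properties.CommutativeSemigroup +-commutativeSemigroup
    using () renaming (interchange to +-interchange; x∙yz≈xz∙y to x+[y+z]≡x+z+y; x∙yz≈y∙xz to x+[y+z]≡y+[x+z])
  open import Algebra.Properties.CommutativeSemigroup *-commutativeSemigroup
    using () renaming (interchange to *-interchange; x∙yz≈y∙xz to x*[y*z]≡y*[x*z])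
  open import Data.Bool using (Bool; true; false; if_then_else_)
  open import Data.Bool.ListAction using (and)
  open import Data.Product using (_×_; _,_; proj₁; proj₂; ∃-syntax)
  open import Data.Sum using (_⊎_; inj₁; inj₂; [_,_]′)
  open import Data.Empty using (⊥-elim)
  open import Data.Fin using (Fin) renaming (zero to fzero; suc to fsuc)
  open import Data.List using (List; []; _∷_; _++_; map; concatMap; concat; replicate; filter; filterᵇ; length; deduplicate; upTo; allFin) renaming (tabulate to tabulateL)
  open import Data.List.Properties using (map-++; map-∘; map-tabulate; upTo-∷ʳ; map-upTo; filter-++; concatMap-++; ++-identityʳ)
  open import Data.List.Membership.Propositional using (_∈_)
  open import Data.List.Membership.Propositional.Properties using (∈-map⁺; ∈-++⁺ˡ; ∈-++⁺ʳ; ∈-deduplicate⁺)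
  open import Data.List.Relation.Unary.Any using (here; there)
  import Data.List.Relation.Unary.All as ListAll
  open ListAll using ([]; _∷_)
  open import Data.List.Relation.Unary.AllPairs using ([]; _∷_)
  open import Data.List.Relation.Unary.Unique.Propositional using (Unique)
  open import Data.List.Relation.Unary.Unique.DecPropositional.Properties using (deduplicate-!)
  open import Data.Vec as V using (Vec; toList; zipWith; _[_]≔_)
  open import Data.Vec.Properties using ([]≔-lookup)
  open import Data.Vec.Relation.Unary.All using (All; []; _∷_)
  open import Data.Vec.Relation.Unary.All.Properties using (lookup⁺)
  open import Function using (id; _∘_; _⇔_; Equivalence)
  open import Relation.Nullary using (¬_; yes; no)
  open import Relation.Nullary.Decidable using (⌊_⌋)
  open import Relation.Binary.Bundles using (Setoid)
  open import Relation.Binary.PropositionalEquality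

  -- Finite sums

  ∑ : {A : Set} → List A → (A → ℕ) → ℕ
  ∑ xs f = sum (map f xs)

  infix 8 ∑ ∏
  syntax ∑ xs (λ x → e) = ∑[ x ← xs ] e

  ∏ : {A : Set} → List A → (A → ℕ) → ℕ
  ∏ xs f = product (map f xs)

  syntax ∏ xs (λ x → e) = ∏[ x ← xs ] e

  𝟙 : Bool → ℕ
  𝟙 b = if b then 1 else 0

  module _ {A : Set} where

    ∑-cong : (xs : List A) {f g : A → ℕ} → (∀ x → f x ≡ g x) → ∑ xs f ≡ ∑ xs g
    ∑-cong []       f≗g = refl
    ∑-cong (x ∷ xs) f≗g = cong₂ _+_ (f≗g x) (∑-cong xs f≗g)

    ∑-++ : (xs ys : List A) (f : A → ℕ) → ∑ (xs ++ ys) f ≡ ∑ xs f + ∑ ys f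
    ∑-++ xs ys f = trans (cong sum (map-++ f xs ys)) (sum-++ (map f xs) (map f ys))

    ∑-zero : (xs : List A) → ∑[ x ← xs ] 0 ≡ 0
    ∑-zero []       = refl
    ∑-zero (x ∷ xs) = ∑-zero xs

    ∑-distrib-+ : (xs : List A) (f g : A → ℕ) → ∑[ x ← xs ] (f x + g x) ≡ ∑ xs f + ∑ xs g
    ∑-distrib-+ []       f g = refl
    ∑-distrib-+ (x ∷ xs) f g =
      trans (cong (f x + g x +_) (∑-distrib-+ xs f g)) (+-interchange (f x) (g x) (∑ xs f) (∑ xs g))

    ∑-*ˡ : (xs : List A) (c : ℕ) (f : A → ℕ) → ∑[ x ← xs ] (c * f x) ≡ c * ∑ xs f
    ∑-*ˡ []       c f = sym (*-zeroʳ c)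
    ∑-*ˡ (x ∷ xs) c f = trans (cong (c * f x +_) (∑-*ˡ xs c f)) (sym (*-distribˡ-+ c (f x) _))

    ∑-*ʳ : (xs : List A) (c : ℕ) (f : A → ℕ) → ∑[ x ← xs ] (f x * c) ≡ ∑ xs f * c
    ∑-*ʳ xs c f = begin
      ∑[ x ← xs ] (f x * c)  ≡⟨ ∑-cong xs (λ x → *-comm (f x) c) ⟩
      ∑[ x ← xs ] (c * f x)  ≡⟨ ∑-*ˡ xs c f ⟩
      c * ∑ xs f             ≡⟨ *-comm c _ ⟩
      ∑ xs f * c             ∎
      where
      open ≡-Reasoning

    ∑-replicate : (k : ℕ) (a : A) (f : A → ℕ) → ∑ (replicate k a) f ≡ k * f a
    ∑-replicate zero    a f = refl
    ∑-replicate (suc k) a f = cong (f a +_) (∑-replicate k a f)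

    length-filterᵇ : (P : A → Bool) (xs : List A) → length (filterᵇ P xs) ≡ ∑[ x ← xs ] 𝟙 (P x)
    length-filterᵇ P []       = refl
    length-filterᵇ P (x ∷ xs) with P x
    ... | true  = cong suc (length-filterᵇ P xs)
    ... | false = length-filterᵇ P xs

    𝟙-and : (P : A → Bool) (xs : List A) → 𝟙 (and (map P xs)) ≡ ∏[ x ← xs ] 𝟙 (P x)
    𝟙-and P []       = refl
    𝟙-and P (x ∷ xs) with P x
    ... | true  = trans (𝟙-and P xs) (sym (+-identityʳ _))
    ... | false = refl

  module _ {A B : Set} where

    ∑-map : (g : A → B) (xs : List A) (f : B → ℕ) → ∑ (map g xs) f ≡ ∑[ x ← xs ] f (g x)
    ∑-map g []       f = refl
    ∑-map g (x ∷ xs) f = cong (f (g x) +_) (∑-map g xs f)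

    ∑-concatMap : (g : A → List B) (xs : List A) (f : B → ℕ) → ∑ (concatMap g xs) f ≡ ∑[ x ← xs ] (∑ (g x) f)
    ∑-concatMap g []       f = refl
    ∑-concatMap g (x ∷ xs) f = trans (∑-++ (g x) (concatMap g xs) f) (cong (∑ (g x) f +_) (∑-concatMap g xs f))

    ∑-comm : (xs : List A) (ys : List B) (f : A → B → ℕ) →
             ∑[ x ← xs ] (∑ ys (f x)) ≡ ∑[ y ← ys ] (∑[ x ← xs ] f x y)
    ∑-comm []       ys f = sym (∑-zero ys)
    ∑-comm (x ∷ xs) ys f = begin
      ∑ ys (f x) + ∑[ x ← xs ] (∑ ys (f x))          ≡⟨ cong (∑ ys (f x) +_) (∑-comm xs ys f) ⟩
      ∑ ys (f x) + ∑[ y ← ys ] (∑[ x ← xs ] f x y)   ≡⟨ ∑-distrib-+ ys (f x) _ ⟨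
      ∑[ y ← ys ] (f x y + ∑[ x ← xs ] f x y)        ∎
      where
      open ≡-Reasoning


  ∑-upTo-suc : (n : ℕ) (f : ℕ → ℕ) → ∑ (upTo (suc n)) f ≡ ∑ (upTo n) f + f n
  ∑-upTo-suc n f = begin
    ∑ (upTo (suc n)) f           ≡⟨ cong (λ xs → ∑ xs f) (upTo-∷ʳ n) ⟨
    ∑ (upTo n ++ n ∷ []) f       ≡⟨ ∑-++ (upTo n) (n ∷ []) f ⟩
    ∑ (upTo n) f + (f n + 0)     ≡⟨ cong (∑ (upTo n) f +_) (+-identityʳ (f n)) ⟩
    ∑ (upTo n) f + f n           ∎
    where
    open ≡-Reasoning

  ∑-upTo-shift : (n : ℕ) (f : ℕ → ℕ) → ∑ (upTo (suc n)) f ≡ f 0 + ∑[ a ← upTo n ] f (suc a)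
  ∑-upTo-shift n f = cong (f 0 +_) (trans (cong (λ xs → ∑ xs f) (sym (map-upTo suc n))) (∑-map suc (upTo n) f))

  -- Binomial coefficients and power sums

  C-absorption : ∀ n k → suc k * (suc n C suc k) ≡ suc n * (n C k)
  C-absorption zero    zero    = refl
  C-absorption zero    (suc k) = begin
    suc (suc k) * (1 C suc (suc k))  ≡⟨ cong (suc (suc k) *_) (k>n⇒nCk≡0 {1} {suc (suc k)} (s≤s (s≤s z≤n))) ⟩
    suc (suc k) * 0                  ≡⟨ *-zeroʳ (suc (suc k)) ⟩
    0                                ≡⟨ cong (1 *_) (k>n⇒nCk≡0 {0} {suc k} (s≤s z≤n)) ⟨
    1 * (0 C suc k)                  ∎
    where
    open ≡-Reasoning
  C-absorption (suc n) zero    = trans (*-identityˡ _) (trans (nC1≡n (suc (suc n))) (sym (*-identityʳ _)))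
  C-absorption (suc n) (suc k) = begin
    k+2 * (n+2 C k+2)                                         ≡⟨ cong (k+2 *_) (nCk+nC[k+1]≡[n+1]C[k+1] (suc n) (suc k)) ⟨
    k+2 * (n+1 C k+1 + n+1 C k+2)                             ≡⟨ *-distribˡ-+ k+2 (n+1 C k+1) _ ⟩
    (n+1 C k+1 + suc k * (n+1 C k+1)) + k+2 * (n+1 C k+2)     ≡⟨ cong₂ (λ a b → (n+1 C k+1 + a) + b) (C-absorption n k) (C-absorption n (suc k)) ⟩
    (n+1 C k+1 + n+1 * (n C k)) + n+1 * (n C suc k)           ≡⟨ +-assoc (n+1 C k+1) _ _ ⟩
    n+1 C k+1 + (n+1 * (n C k) + n+1 * (n C suc k))           ≡⟨ cong (n+1 C k+1 +_) (*-distribˡ-+ n+1 (n C k) _) ⟨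
    n+1 C k+1 + n+1 * (n C k + n C suc k)                     ≡⟨ cong (λ c → n+1 C k+1 + n+1 * c) (nCk+nC[k+1]≡[n+1]C[k+1] n k) ⟩
    n+2 * (n+1 C k+1)                                         ∎
    where
    open ≡-Reasoning
    n+1 = suc n
    n+2 = suc (suc n)
    k+1 = suc k
    k+2 = suc (suc k)

  C-pred : ∀ n → suc n C n ≡ suc n
  C-pred n = begin
    suc n C n            ≡⟨ nCk≡nC[n∸k] (n≤1+n n) ⟩
    suc n C (suc n ∸ n)  ≡⟨ cong (suc n C_) (m+n∸n≡m 1 n) ⟩
    suc n C 1            ≡⟨ nC1≡n (suc n) ⟩
    suc n                ∎
    where
    open ≡-Reasoning

  binomial : ∀ a n → suc a ^ n ≡ ∑[ k ← upTo (suc n) ] ((n C k) * a ^ k)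
  binomial a zero    = refl
  binomial a (suc n) = sym (begin
    ∑[ k ← upTo (suc (suc n)) ] ((suc n C k) * a ^ k)          ≡⟨ ∑-upTo-shift (suc n) (λ k → (suc n C k) * a ^ k) ⟩
    1 + ∑[ k ← upTo (suc n) ] ((suc n C suc k) * a ^ suc k)    ≡⟨ cong (1 +_) (∑-cong (upTo (suc n)) pascal) ⟩
    1 + ∑[ k ← upTo (suc n) ] (a * c k + c′ k)                  ≡⟨ cong (1 +_) (∑-distrib-+ (upTo (suc n)) (λ k → a * c k) c′) ⟩
    1 + (∑[ k ← upTo (suc n) ] (a * c k) + T)                  ≡⟨ cong (λ s → 1 + (s + T)) (∑-*ˡ (upTo (suc n)) a c) ⟩
    1 + (a * B + T)                                            ≡⟨ x+[y+z]≡y+[x+z] 1 (a * B) T ⟩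
    a * B + (1 + T)                                            ≡⟨ cong (a * B +_) shifted ⟨
    a * B + B                                                  ≡⟨ +-comm (a * B) B ⟩
    suc a * B                                                  ≡⟨ cong (suc a *_) (binomial a n) ⟨
    suc a * suc a ^ n                                          ∎)
    where
    open ≡-Reasoning
    c c′ : ℕ → ℕ
    c  k = (n C k) * a ^ k
    c′ k = (n C suc k) * a ^ suc k
    B = ∑ (upTo (suc n)) c
    T = ∑ (upTo (suc n)) c′
    pascal : ∀ k → (suc n C suc k) * a ^ suc k ≡ a * c k + c′ k
    pascal k = begin
      (suc n C suc k) * (a * a ^ k)                   ≡⟨ cong (_* (a * a ^ k)) (nCk+nC[k+1]≡[n+1]C[k+1] n k) ⟨
      (n C k + n C suc k) * (a * a ^ k)               ≡⟨ *-distribʳ-+ (a * a ^ k) (n C k) _ ⟩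
      (n C k) * (a * a ^ k) + c′ k                    ≡⟨ cong (_+ c′ k) (x*[y*z]≡y*[x*z] (n C k) a (a ^ k)) ⟩
      a * c k + c′ k                                  ∎
    shifted : B ≡ 1 + T
    shifted = begin
      B                                               ≡⟨ +-identityʳ B ⟨
      B + 0                                           ≡⟨ cong (λ z → B + z * a ^ suc n) (k>n⇒nCk≡0 (n<1+n n)) ⟨
      B + c (suc n)                                   ≡⟨ ∑-upTo-suc (suc n) c ⟨
      ∑ (upTo (suc (suc n))) c                        ≡⟨ ∑-upTo-shift (suc n) c ⟩
      1 + T                                           ∎

  powerSum : ℕ → ℕ → ℕ
  powerSum n k = ∑[ a ← upTo n ] a ^ k

  ∑-upTo-const : ∀ n c → ∑[ a ← upTo n ] c ≡ n * c
  ∑-upTo-const zero    c = refl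
  ∑-upTo-const (suc n) c = trans (∑-upTo-suc n (λ _ → c)) (trans (cong (_+ c) (∑-upTo-const n c)) (+-comm (n * c) c))

  powerSum-zero : ∀ n → powerSum n 0 ≡ n
  powerSum-zero n = trans (∑-upTo-const n 1) (*-identityʳ n)

  ∑-binomial-powerSum : ∀ n k → ∑[ j ← upTo (suc k) ] ((suc k C j) * powerSum n j) ≡ n ^ suc k
  ∑-binomial-powerSum n k = +-cancelʳ-≡ (powerSum n (suc k)) _ _ (begin
    ∑ (upTo (suc k)) c + S (suc k)                                 ≡⟨ cong (∑ (upTo (suc k)) c +_) (*-identityˡ (S (suc k))) ⟨
    ∑ (upTo (suc k)) c + 1 * S (suc k)                             ≡⟨ cong (λ m → ∑ (upTo (suc k)) c + m * S (suc k)) (nCn≡1 (suc k)) ⟨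
    ∑ (upTo (suc k)) c + (suc k C suc k) * S (suc k)               ≡⟨ ∑-upTo-suc (suc k) c ⟨
    ∑ (upTo (suc (suc k))) c                                       ≡⟨ ∑-cong (upTo (suc (suc k))) (λ j → ∑-*ˡ (upTo n) (suc k C j) (λ a → a ^ j)) ⟨
    ∑[ j ← upTo (suc (suc k)) ] (∑[ a ← upTo n ] ((suc k C j) * a ^ j))
                                                                   ≡⟨ ∑-comm (upTo (suc (suc k))) (upTo n) (λ j a → (suc k C j) * a ^ j) ⟩
    ∑[ a ← upTo n ] (∑[ j ← upTo (suc (suc k)) ] ((suc k C j) * a ^ j))
                                                                   ≡⟨ ∑-cong (upTo n) (λ a → binomial a (suc k)) ⟨
    ∑[ a ← upTo n ] suc a ^ suc k                                  ≡⟨ ∑-upTo-shift n (λ a → a ^ suc k) ⟨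
    ∑[ a ← upTo (suc n) ] a ^ suc k                                ≡⟨ ∑-upTo-suc n (λ a → a ^ suc k) ⟩
    S (suc k) + n ^ suc k                                          ≡⟨ +-comm (S (suc k)) _ ⟩
    n ^ suc k + S (suc k)                                          ∎)
    where
    open ≡-Reasoning
    S = powerSum n
    c : ℕ → ℕ
    c j = (suc k C j) * S j

  -- Arithmetic modulo p

  -- Parametrised by p − 1 so that p ∸ 1 and modP p compute.
  module Modulo (p-1 : ℕ) where

    p : ℕ
    p = suc p-1

    infix 4 _≈_
    -- A record rather than a synonym, so that a and b can be inferred from a ≈ b.
    record _≈_ (a b : ℕ) : Set where
      constructor mk≈
      field %-≡ : a % p ≡ b % p

    open _≈_ public

    ≈-refl : ∀ {a} → a ≈ a
    ≈-refl = mk≈ refl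

    ≈-sym : ∀ {a b} → a ≈ b → b ≈ a
    ≈-sym (mk≈ e) = mk≈ (sym e)

    ≈-trans : ∀ {a b c} → a ≈ b → b ≈ c → a ≈ c
    ≈-trans (mk≈ e) (mk≈ e′) = mk≈ (trans e e′)

    ≈-setoid : Setoid _ _
    ≈-setoid = record
      { Carrier = ℕ ; _≈_ = _≈_
      ; isEquivalence = record { refl = ≈-refl ; sym = ≈-sym ; trans = ≈-trans } }

    ≡⇒≈ : ∀ {a b} → a ≡ b → a ≈ b
    ≡⇒≈ e = mk≈ (cong (_% p) e)

    +-cong : ∀ {a b c d} → a ≈ b → c ≈ d → a + c ≈ b + d
    +-cong {a} {b} {c} {d} (mk≈ e) (mk≈ e′) = mk≈ (begin
      (a + c) % p                ≡⟨ %-distribˡ-+ a c p ⟩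
      (a % p + c % p) % p        ≡⟨ cong₂ (λ x y → (x + y) % p) e e′ ⟩
      (b % p + d % p) % p        ≡⟨ %-distribˡ-+ b d p ⟨
      (b + d) % p                ∎)
      where
      open ≡-Reasoning

    *-cong : ∀ {a b c d} → a ≈ b → c ≈ d → a * c ≈ b * d
    *-cong {a} {b} {c} {d} (mk≈ e) (mk≈ e′) = mk≈ (begin
      (a * c) % p                ≡⟨ %-distribˡ-* a c p ⟩
      (a % p * (c % p)) % p      ≡⟨ cong₂ (λ x y → (x * y) % p) e e′ ⟩
      (b % p * (d % p)) % p      ≡⟨ %-distribˡ-* b d p ⟨
      (b * d) % p                ∎)
      where
      open ≡-Reasoning

    +-≈0ʳ : ∀ a {b} → b ≈ 0 → a + b ≈ a
    +-≈0ʳ a b≈0 = ≈-trans (+-cong (≈-refl {a}) b≈0) (≡⇒≈ (+-identityʳ a))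

    ^-cong : ∀ {a b} k → a ≈ b → a ^ k ≈ b ^ k
    ^-cong zero    a≈b = ≈-refl
    ^-cong (suc k) a≈b = *-cong a≈b (^-cong k a≈b)

    ∑-cong-≈ : ∀ {A : Set} (xs : List A) {f g : A → ℕ} → (∀ x → f x ≈ g x) → ∑ xs f ≈ ∑ xs g
    ∑-cong-≈ []       f≈g = ≈-refl
    ∑-cong-≈ (x ∷ xs) f≈g = +-cong (f≈g x) (∑-cong-≈ xs f≈g)

    ∏-cong-≈ : ∀ {A : Set} (xs : List A) {f g : A → ℕ} → (∀ x → f x ≈ g x) → ∏ xs f ≈ ∏ xs g
    ∏-cong-≈ []       f≈g = ≈-refl
    ∏-cong-≈ (x ∷ xs) f≈g = *-cong (f≈g x) (∏-cong-≈ xs f≈g)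

    ∑-upTo-cong-≈ : ∀ n {f g : ℕ → ℕ} → (∀ a → a < n → f a ≈ g a) → ∑ (upTo n) f ≈ ∑ (upTo n) g
    ∑-upTo-cong-≈ zero    f≈g = ≈-refl
    ∑-upTo-cong-≈ (suc n) {f} {g} f≈g = begin
      ∑ (upTo (suc n)) f    ≡⟨ ∑-upTo-suc n f ⟩
      ∑ (upTo n) f + f n    ≈⟨ +-cong (∑-upTo-cong-≈ n (λ a a<n → f≈g a (m<n⇒m<1+n a<n))) (f≈g n (n<1+n n)) ⟩
      ∑ (upTo n) g + g n    ≡⟨ ∑-upTo-suc n g ⟨
      ∑ (upTo (suc n)) g    ∎
      where
      open import Relation.Binary.Reasoning.Setoid ≈-setoid

    ∑-upTo-≈0 : ∀ n {f : ℕ → ℕ} → (∀ a → a < n → f a ≈ 0) → ∑ (upTo n) f ≈ 0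
    ∑-upTo-≈0 n f≈0 = ≈-trans (∑-upTo-cong-≈ n f≈0) (≡⇒≈ (∑-zero (upTo n)))

    %-≈ : ∀ a → a % p ≈ a
    %-≈ a = mk≈ (m%n%n≡m%n a p)

    p≈0 : p ≈ 0
    p≈0 = mk≈ (n%n≡0 p)

    *p≈0 : ∀ m → m * p ≈ 0
    *p≈0 m = mk≈ (m*n%n≡0 m p)

    p*≈0 : ∀ m → p * m ≈ 0
    p*≈0 m = ≈-trans (≡⇒≈ (*-comm p m)) (*p≈0 m)

    ∣⇒≈0 : ∀ {a} → p ∣ a → a ≈ 0
    ∣⇒≈0 {a} p∣a = mk≈ (n∣m⇒m%n≡0 a p p∣a)

    ∣∸⇒≈ : ∀ {a b} → b ≤ a → p ∣ a ∸ b → a ≈ b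
    ∣∸⇒≈ {a} {b} b≤a p∣a∸b = mk≈ (trans (cong (_% p) (sym (m∸n+n≡m b≤a))) (%-remove-+ˡ b p∣a∸b))

    ≈⇒∣∸ : ∀ {a b} → a ≈ b → p ∣ a ∸ b
    ≈⇒∣∸ {a} {b} (mk≈ e) = divides (a / p ∸ b / p) (begin
      a ∸ b                                        ≡⟨ cong₂ _∸_ (m≡m%n+[m/n]*n a p) (m≡m%n+[m/n]*n b p) ⟩
      (a % p + a / p * p) ∸ (b % p + b / p * p)    ≡⟨ cong (λ r → (a % p + a / p * p) ∸ (r + b / p * p)) e ⟨
      (a % p + a / p * p) ∸ (a % p + b / p * p)    ≡⟨ [m+n]∸[m+o]≡n∸o (a % p) _ _ ⟩
      a / p * p ∸ b / p * p                        ≡⟨ *-distribʳ-∸ p (a / p) (b / p) ⟨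
      (a / p ∸ b / p) * p                          ∎)
      where
      open ≡-Reasoning

    <⇒≉0 : ∀ {a} → 0 < a → a < p → ¬ a ≈ 0
    <⇒≉0 {suc a} _ a<p (mk≈ e) with () ← trans (sym (m<n⇒m%n≡m a<p)) e

  _∣⁺_ : ℕ → ℕ → Set
  q ∣⁺ e = ∃[ i ] e ≡ q * suc i

  module ModPrime (r : ℕ) (p-prime : Prime (2 + r)) where

    q : ℕ
    q = 1 + r

    open Modulo q public
    open import Relation.Binary.Reasoning.Setoid ≈-setoid

    *-cancelˡ-≈ : ∀ {a x y} → ¬ a ≈ 0 → a * x ≈ a * y → x ≈ y
    *-cancelˡ-≈ {a} {x} {y} a≉0 ax≈ay =
      [ cancel ax≈ay , (λ x≤y → ≈-sym (cancel (≈-sym ax≈ay) x≤y)) ]′ (≤-total y x)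
      where
      cancel : ∀ {x y} → a * x ≈ a * y → y ≤ x → x ≈ y
      cancel {x} {y} ax≈ay y≤x with euclidsLemma a (x ∸ y) p-prime (subst (p ∣_) (sym (*-distribˡ-∸ a x y)) (≈⇒∣∸ ax≈ay))
      ... | inj₁ p∣a   = ⊥-elim (a≉0 (∣⇒≈0 p∣a))
      ... | inj₂ p∣x∸y = ∣∸⇒≈ y≤x p∣x∸y

    pC[1+k]≈0 : ∀ {k} → suc k < p → p C suc k ≈ 0
    pC[1+k]≈0 {k} k+1<p = *-cancelˡ-≈ (<⇒≉0 (s≤s z≤n) k+1<p) (begin
      suc k * (p C suc k)   ≡⟨ C-absorption q k ⟩
      p * (q C k)           ≈⟨ p*≈0 (q C k) ⟩
      0                     ≡⟨ *-zeroʳ (suc k) ⟨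
      suc k * 0             ∎)

    fermat : ∀ a → a ^ p ≈ a
    fermat zero    = ≈-refl
    fermat (suc a) = begin
      suc a ^ p                                                       ≡⟨ binomial a p ⟩
      ∑[ k ← upTo (suc p) ] ((p C k) * a ^ k)                         ≡⟨ ∑-upTo-suc p (λ k → (p C k) * a ^ k) ⟩
      ∑[ k ← upTo p ] ((p C k) * a ^ k) + (p C p) * a ^ p             ≡⟨ cong₂ _+_ (∑-upTo-shift q (λ k → (p C k) * a ^ k)) (cong (_* a ^ p) (nCn≡1 p)) ⟩
      (1 + ∑[ k ← upTo q ] ((p C suc k) * a ^ suc k)) + 1 * a ^ p     ≈⟨ +-cong (+-cong (≈-refl {1}) inner≈0) (*-cong (≈-refl {1}) (fermat a)) ⟩
      (1 + 0) + 1 * a                                                 ≡⟨ cong suc (+-identityʳ a) ⟩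
      suc a                                                           ∎
      where
      inner≈0 : ∑[ k ← upTo q ] ((p C suc k) * a ^ suc k) ≈ 0
      inner≈0 = ∑-upTo-≈0 q (λ k k<q → *-cong (pC[1+k]≈0 (s≤s k<q)) (≈-refl {a ^ suc k}))

    fermat-unit : ∀ {a} → ¬ a ≈ 0 → a ^ q ≈ 1
    fermat-unit {a} a≉0 = *-cancelˡ-≈ a≉0 (≈-trans (fermat a) (≡⇒≈ (sym (*-identityʳ a))))

    S : ℕ → ℕ
    S = powerSum p

    S-zero≈0 : S 0 ≈ 0
    S-zero≈0 = ≈-trans (≡⇒≈ (powerSum-zero p)) p≈0

    S≈0 : ∀ k → k < q → S k ≈ 0
    S≈0 = <-rec (λ k → k < q → S k ≈ 0) step
      where
      step : ∀ k → (∀ {j} → j < k → j < q → S j ≈ 0) → k < q → S k ≈ 0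
      step zero    _  _   = S-zero≈0
      step (suc k) ih k<q = *-cancelˡ-≈ (<⇒≉0 (s≤s z≤n) (s≤s k<q)) (begin
        (2 + k) * S (suc k)                          ≡⟨ cong (_* S (suc k)) (C-pred (suc k)) ⟨
        c (suc k)                                    ≈⟨ +-cong lower≈0 (≈-refl {c (suc k)}) ⟨
        ∑ (upTo (suc k)) c + c (suc k)               ≡⟨ ∑-upTo-suc (suc k) c ⟨
        ∑ (upTo (suc (suc k))) c                     ≡⟨ ∑-binomial-powerSum p (suc k) ⟩
        p ^ (2 + k)                                  ≈⟨ p*≈0 (p ^ suc k) ⟩
        0                                            ≡⟨ *-zeroʳ (2 + k) ⟨
        (2 + k) * 0                                  ∎)
        where
        c : ℕ → ℕ
        c j = ((2 + k) C j) * S j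
        lower≈0 : ∑ (upTo (suc k)) c ≈ 0
        lower≈0 = ∑-upTo-≈0 (suc k) (λ j j<k+1 →
          ≈-trans (*-cong (≈-refl {(2 + k) C j}) (ih j<k+1 (<-trans j<k+1 k<q))) (≡⇒≈ (*-zeroʳ ((2 + k) C j))))

    S-q≈q : S q ≈ q
    S-q≈q = begin
      S q                                ≡⟨ ∑-upTo-shift q (λ a → a ^ q) ⟩
      ∑[ a ← upTo q ] suc a ^ q          ≈⟨ ∑-upTo-cong-≈ q (λ a a<q → fermat-unit (<⇒≉0 (s≤s z≤n) (s≤s a<q))) ⟩
      ∑[ a ← upTo q ] 1                  ≡⟨ trans (∑-upTo-const q 1) (*-identityʳ q) ⟩
      q                                  ∎

    S-+q : ∀ k → S (suc k + q) ≈ S (suc k)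
    S-+q k = ∑-cong-≈ (upTo p) period
      where
      period : ∀ a → a ^ (suc k + q) ≈ a ^ suc k
      period a = begin
        a ^ (suc k + q)     ≡⟨ cong (a ^_) (+-suc k q) ⟨
        a ^ (k + p)         ≡⟨ ^-distribˡ-+-* a k p ⟩
        a ^ k * a ^ p       ≈⟨ *-cong (≈-refl {a ^ k}) (fermat a) ⟩
        a ^ k * a           ≡⟨ *-comm (a ^ k) a ⟩
        a ^ suc k           ∎

    S-periodic : ∀ k i → S (suc k + i * q) ≈ S (suc k)
    S-periodic k zero    = ≡⇒≈ (cong S (+-identityʳ (suc k)))
    S-periodic k (suc i) = begin
      S (suc k + (q + i * q))    ≡⟨ cong S (trans (cong (suc k +_) (+-comm q (i * q))) (sym (+-assoc (suc k) (i * q) q))) ⟩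
      S (suc (k + i * q) + q)    ≈⟨ S-+q (k + i * q) ⟩
      S (suc k + i * q)          ≈⟨ S-periodic k i ⟩
      S (suc k)                  ∎

    q∣⁺⊎S≈0 : ∀ e → q ∣⁺ e ⊎ S e ≈ 0
    q∣⁺⊎S≈0 zero    = inj₂ S-zero≈0
    q∣⁺⊎S≈0 (suc k) with m≤n⇒m<n∨m≡n (m%n<n k q)
    ... | inj₁ k%q+1<q = inj₂ (begin
      S (suc k)                      ≡⟨ cong (S ∘ suc) (m≡m%n+[m/n]*n k q) ⟩
      S (suc (k % q) + k / q * q)    ≈⟨ S-periodic (k % q) (k / q) ⟩
      S (suc (k % q))                ≈⟨ S≈0 (suc (k % q)) k%q+1<q ⟩
      0                              ∎)
    ... | inj₂ k%q+1≡q = inj₁ (k / q ,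
      trans (cong suc (m≡m%n+[m/n]*n k q)) (trans (cong₂ _+_ k%q+1≡q (*-comm (k / q) q)) (sym (*-suc q (k / q)))))

  -- Polynomials

  evalMono : ∀ {n} → Vec ℕ n → Exp n → ℕ
  evalMono x α = product (toList (zipWith _^_ x α))

  evalTerm : ∀ {n} → Vec ℕ n → ℕ × Exp n → ℕ
  evalTerm x t = proj₁ t * evalMono x (proj₂ t)

  -- Evaluation in ℕ, before reduction: eval p P x is definitionally modP p (⟦ P ⟧ x).
  ⟦_⟧ : ∀ {n} → Poly n → Vec ℕ n → ℕ
  ⟦ P ⟧ x = ∑ P (evalTerm x)

  evalMono-zeroExp : ∀ {n} (x : Vec ℕ n) → evalMono x zeroExp ≡ 1
  evalMono-zeroExp V.[]      = refl
  evalMono-zeroExp (a V.∷ x) = trans (+-identityʳ _) (evalMono-zeroExp x)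

  evalMono-+ : ∀ {n} (x α β : Vec ℕ n) → evalMono x (zipWith _+_ α β) ≡ evalMono x α * evalMono x β
  evalMono-+ V.[]      V.[]      V.[]      = refl
  evalMono-+ (a V.∷ x) (i V.∷ α) (j V.∷ β) = begin
    a ^ (i + j) * evalMono x (zipWith _+_ α β)         ≡⟨ cong₂ _*_ (^-distribˡ-+-* a i j) (evalMono-+ x α β) ⟩
    (a ^ i * a ^ j) * (evalMono x α * evalMono x β)    ≡⟨ *-interchange (a ^ i) (a ^ j) _ _ ⟩
    (a ^ i * evalMono x α) * (a ^ j * evalMono x β)    ∎
    where
    open ≡-Reasoning

  evalMono-monProd : ∀ {n} (x : Vec ℕ n) (αs : List (Exp n)) → evalMono x (monProd αs) ≡ ∏ αs (evalMono x)
  evalMono-monProd x []       = evalMono-zeroExp x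
  evalMono-monProd x (α ∷ αs) = trans (evalMono-+ x α (monProd αs)) (cong (evalMono x α *_) (evalMono-monProd x αs))

  evalMono-unit : ∀ {n} (x : Vec ℕ n) j k → evalMono x (zeroExp [ j ]≔ k) ≡ V.lookup x j ^ k
  evalMono-unit (a V.∷ x) fzero    k = trans (cong (a ^ k *_) (evalMono-zeroExp x)) (*-identityʳ _)
  evalMono-unit (a V.∷ x) (fsuc j) k = trans (*-identityˡ _) (evalMono-unit x j k)

  module _ {n : ℕ} (x : Vec ℕ n) where

    ⟦⟧-++ : (P Q : Poly n) → ⟦ P ++ Q ⟧ x ≡ ⟦ P ⟧ x + ⟦ Q ⟧ x
    ⟦⟧-++ P Q = ∑-++ P Q (evalTerm x)

    ⟦⟧-*P : (P Q : Poly n) → ⟦ P *P Q ⟧ x ≡ ⟦ P ⟧ x * ⟦ Q ⟧ x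
    ⟦⟧-*P []      Q = refl
    ⟦⟧-*P (t ∷ P) Q = begin
      ⟦ map (t ·_) Q ++ (P *P Q) ⟧ x                  ≡⟨ ⟦⟧-++ (map (t ·_) Q) (P *P Q) ⟩
      ⟦ map (t ·_) Q ⟧ x + ⟦ P *P Q ⟧ x               ≡⟨ cong₂ _+_ term (⟦⟧-*P P Q) ⟩
      evalTerm x t * ⟦ Q ⟧ x + ⟦ P ⟧ x * ⟦ Q ⟧ x      ≡⟨ *-distribʳ-+ (⟦ Q ⟧ x) (evalTerm x t) (⟦ P ⟧ x) ⟨
      (evalTerm x t + ⟦ P ⟧ x) * ⟦ Q ⟧ x              ∎
      where
      open ≡-Reasoning
      _·_ : ℕ × Exp n → ℕ × Exp n → ℕ × Exp n
      t · u = (proj₁ t * proj₁ u , zipWith _+_ (proj₂ t) (proj₂ u))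
      term : ⟦ map (t ·_) Q ⟧ x ≡ evalTerm x t * ⟦ Q ⟧ x
      term = begin
        ⟦ map (t ·_) Q ⟧ x                            ≡⟨ ∑-map (t ·_) Q (evalTerm x) ⟩
        ∑[ u ← Q ] evalTerm x (t · u)                 ≡⟨ ∑-cong Q (λ u → cong (proj₁ t * proj₁ u *_) (evalMono-+ x (proj₂ t) (proj₂ u))) ⟩
        ∑[ u ← Q ] ((proj₁ t * proj₁ u) * (evalMono x (proj₂ t) * evalMono x (proj₂ u)))
                                                      ≡⟨ ∑-cong Q (λ u → *-interchange (proj₁ t) (proj₁ u) _ _) ⟩
        ∑[ u ← Q ] (evalTerm x t * evalTerm x u)      ≡⟨ ∑-*ˡ Q (evalTerm x t) (evalTerm x) ⟩
        evalTerm x t * ⟦ Q ⟧ x                        ∎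

    ⟦⟧-mono : (α : Exp n) → ⟦ mono α ⟧ x ≡ evalMono x α
    ⟦⟧-mono α = trans (+-identityʳ _) (*-identityˡ _)

    ⟦⟧-onePoly : ⟦ onePoly ⟧ x ≡ 1
    ⟦⟧-onePoly = trans (⟦⟧-mono zeroExp) (evalMono-zeroExp x)

    ⟦⟧-^P : (P : Poly n) (k : ℕ) → ⟦ P ^P k ⟧ x ≡ ⟦ P ⟧ x ^ k
    ⟦⟧-^P P zero    = ⟦⟧-onePoly
    ⟦⟧-^P P (suc k) = trans (⟦⟧-*P P (P ^P k)) (cong (⟦ P ⟧ x *_) (⟦⟧-^P P k))

    ⟦⟧-scale : (c : ℕ) (P : Poly n) → ⟦ scale c P ⟧ x ≡ c * ⟦ P ⟧ x
    ⟦⟧-scale c P = begin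
      ⟦ scale c P ⟧ x                                      ≡⟨ ∑-map _ P (evalTerm x) ⟩
      ∑[ t ← P ] ((c * proj₁ t) * evalMono x (proj₂ t))    ≡⟨ ∑-cong P (λ t → *-assoc c (proj₁ t) _) ⟩
      ∑[ t ← P ] (c * evalTerm x t)                        ≡⟨ ∑-*ˡ P c (evalTerm x) ⟩
      c * ⟦ P ⟧ x                                          ∎
      where
      open ≡-Reasoning

    ⟦⟧-minusP : (p : ℕ) (P Q : Poly n) → ⟦ minusP p P Q ⟧ x ≡ ⟦ P ⟧ x + (p ∸ 1) * ⟦ Q ⟧ x
    ⟦⟧-minusP p P Q = trans (⟦⟧-++ P (scale (p ∸ 1) Q)) (cong (⟦ P ⟧ x +_) (⟦⟧-scale (p ∸ 1) Q))

  ∑-choices : ∀ {A : Set} (xss : List (List A)) (f : A → ℕ) →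
              ∑[ ys ← choices xss ] ∏ ys f ≡ ∏[ xs ← xss ] ∑ xs f
  ∑-choices []         f = refl
  ∑-choices (xs ∷ xss) f = begin
    ∑ (concatMap (λ a → map (a ∷_) (choices xss)) xs) Πf    ≡⟨ ∑-concatMap _ xs Πf ⟩
    ∑[ a ← xs ] ∑ (map (a ∷_) (choices xss)) Πf             ≡⟨ ∑-cong xs (λ a → trans (∑-map (a ∷_) (choices xss) Πf) (∑-*ˡ (choices xss) (f a) Πf)) ⟩
    ∑[ a ← xs ] (f a * ∑ (choices xss) Πf)                  ≡⟨ ∑-*ʳ xs _ f ⟩
    ∑ xs f * ∑ (choices xss) Πf                             ≡⟨ cong (∑ xs f *_) (∑-choices xss f) ⟩
    ∑ xs f * ∏[ xs ← xss ] ∑ xs f                           ∎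
    where
    open ≡-Reasoning
    Πf : List _ → ℕ
    Πf ys = ∏ ys f

  rawCoeff : ∀ {n} → Poly n → Exp n → ℕ
  rawCoeff P α = sum (map proj₁ (filter (λ t → proj₂ t ≟e α) P))

  δ : ∀ {n} → Exp n → Exp n → ℕ
  δ β α = 𝟙 ⌊ β ≟e α ⌋

  rawCoeff-∷ : ∀ {n} (t : ℕ × Exp n) P α → rawCoeff (t ∷ P) α ≡ δ (proj₂ t) α * proj₁ t + rawCoeff P α
  rawCoeff-∷ t P α with proj₂ t ≟e α
  ... | yes _ = cong (_+ rawCoeff P α) (sym (+-identityʳ _))
  ... | no  _ = refl

  rawCoeff-++ : ∀ {n} (P Q : Poly n) α → rawCoeff (P ++ Q) α ≡ rawCoeff P α + rawCoeff Q α
  rawCoeff-++ P Q α = trans (cong (sum ∘ map proj₁) (filter-++ (λ t → proj₂ t ≟e α) P Q))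
                            (∑-++ (filter (λ t → proj₂ t ≟e α) P) (filter (λ t → proj₂ t ≟e α) Q) proj₁)

  rawCoeff-scale : ∀ {n} c (P : Poly n) α → rawCoeff (scale c P) α ≡ c * rawCoeff P α
  rawCoeff-scale c []      α = sym (*-zeroʳ c)
  rawCoeff-scale c (t ∷ P) α with proj₂ t ≟e α
  ... | yes _ = trans (cong (c * proj₁ t +_) (rawCoeff-scale c P α)) (sym (*-distribˡ-+ c (proj₁ t) _))
  ... | no  _ = rawCoeff-scale c P α

  rawCoeff-minusP : ∀ {n} p (P Q : Poly n) α → rawCoeff (minusP p P Q) α ≡ rawCoeff P α + (p ∸ 1) * rawCoeff Q α
  rawCoeff-minusP p P Q α = trans (rawCoeff-++ P (scale (p ∸ 1) Q) α) (cong (rawCoeff P α +_) (rawCoeff-scale (p ∸ 1) Q α))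

  ∑-δ-∉ : ∀ {n} (β : Exp n) (D : List (Exp n)) (f : Exp n → ℕ) → ListAll.All (β ≢_) D → ∑[ α ← D ] (δ β α * f α) ≡ 0
  ∑-δ-∉ β []      f []           = refl
  ∑-δ-∉ β (γ ∷ D) f (β≢γ ∷ β∉D) with β ≟e γ
  ... | yes β≡γ = ⊥-elim (β≢γ β≡γ)
  ... | no  _   = ∑-δ-∉ β D f β∉D

  ∑-δ-∈ : ∀ {n} {β : Exp n} {D : List (Exp n)} (f : Exp n → ℕ) → Unique D → β ∈ D → ∑[ α ← D ] (δ β α * f α) ≡ f β
  ∑-δ-∈ {β = β} {γ ∷ D} f (γ∉D ∷ _) (here refl) with β ≟e β
  ... | yes _   = trans (cong₂ _+_ (+-identityʳ (f β)) (∑-δ-∉ β D f γ∉D)) (+-identityʳ (f β))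
  ... | no β≢β  = ⊥-elim (β≢β refl)
  ∑-δ-∈ {β = β} {γ ∷ D} f (γ∉D ∷ D!) (there β∈D) with β ≟e γ
  ... | yes refl = ⊥-elim (ListAll.lookup γ∉D β∈D refl)
  ... | no  _    = ∑-δ-∈ f D! β∈D

  ∑-rawCoeff : ∀ {n} (x : Vec ℕ n) {D : List (Exp n)} → Unique D → (P : Poly n) → ListAll.All (λ t → proj₂ t ∈ D) P →
               ∑[ α ← D ] (rawCoeff P α * evalMono x α) ≡ ⟦ P ⟧ x
  ∑-rawCoeff x {D} D! []      []          = ∑-zero D
  ∑-rawCoeff {n} x {D} D! (t ∷ P) (t∈D ∷ P⊆D) = begin
    ∑[ α ← D ] (rawCoeff (t ∷ P) α * evalMono x α)                              ≡⟨ ∑-cong D split ⟩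
    ∑[ α ← D ] (δ (proj₂ t) α * evalTerm′ α + rawCoeff P α * evalMono x α)      ≡⟨ ∑-distrib-+ D (λ α → δ (proj₂ t) α * evalTerm′ α) (λ α → rawCoeff P α * evalMono x α) ⟩
    ∑[ α ← D ] (δ (proj₂ t) α * evalTerm′ α) + ∑[ α ← D ] (rawCoeff P α * evalMono x α)
                                                                                ≡⟨ cong₂ _+_ (∑-δ-∈ evalTerm′ D! t∈D) (∑-rawCoeff x D! P P⊆D) ⟩
    evalTerm x t + ⟦ P ⟧ x                                                      ∎
    where
    open ≡-Reasoning
    evalTerm′ : Exp n → ℕ
    evalTerm′ α = proj₁ t * evalMono x α
    split : ∀ α → rawCoeff (t ∷ P) α * evalMono x α ≡ δ (proj₂ t) α * evalTerm′ α + rawCoeff P α * evalMono x α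
    split α = begin
      rawCoeff (t ∷ P) α * evalMono x α                                         ≡⟨ cong (_* evalMono x α) (rawCoeff-∷ t P α) ⟩
      (δ (proj₂ t) α * proj₁ t + rawCoeff P α) * evalMono x α                   ≡⟨ *-distribʳ-+ (evalMono x α) (δ (proj₂ t) α * proj₁ t) (rawCoeff P α) ⟩
      δ (proj₂ t) α * proj₁ t * evalMono x α + rawCoeff P α * evalMono x α      ≡⟨ cong (_+ rawCoeff P α * evalMono x α) (*-assoc (δ (proj₂ t) α) _ _) ⟩
      δ (proj₂ t) α * evalTerm′ α + rawCoeff P α * evalMono x α                 ∎

  exponents : ∀ {n} → Poly n → List (Exp n)
  exponents P = deduplicate _≟e_ (map proj₂ P)

  exponents-⊇ : ∀ {n} {P L : Poly n} → (∀ {t} → t ∈ P → t ∈ L) → ListAll.All (λ t → proj₂ t ∈ exponents L) P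
  exponents-⊇ P⊆L = ListAll.tabulate (λ t∈P → ∈-deduplicate⁺ _≟e_ (∈-map⁺ proj₂ (P⊆L t∈P)))

  ∑-rawCoeff-exponents : ∀ {n} (x : Vec ℕ n) {P L : Poly n} → (∀ {t} → t ∈ P → t ∈ L) →
                         ∑[ α ← exponents L ] (rawCoeff P α * evalMono x α) ≡ ⟦ P ⟧ x
  ∑-rawCoeff-exponents x {P} {L} P⊆L = ∑-rawCoeff x (deduplicate-! _≟e_ (map proj₂ L)) P (exponents-⊇ P⊆L)

  -- CongIdeal p P Q unfolds to PolyEq p (minusP p P Q) (linComb h (fieldEq p)) for some h.
  linComb : ∀ {n k} → Vec (Poly n) k → (Fin k → Poly n) → Poly n
  linComb h F = concat (tabulateL (λ j → V.lookup h j *P F j))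

  linComb-zeros : ∀ {n k} (F : Fin k → Poly n) → linComb (V.replicate k []) F ≡ []
  linComb-zeros {k = zero}  F = refl
  linComb-zeros {k = suc k} F = linComb-zeros (F ∘ fsuc)

  linComb-single : ∀ {n k} (j : Fin k) (P : Poly n) (F : Fin k → Poly n) →
                   linComb (V.replicate k [] [ j ]≔ P) F ≡ P *P F j
  linComb-single {k = suc k} fzero    P F = trans (cong (P *P F fzero ++_) (linComb-zeros (F ∘ fsuc))) (++-identityʳ _)
  linComb-single {k = suc k} (fsuc j) P F = linComb-single j P (F ∘ fsuc)

  rawCoeff-linComb-++ : ∀ {n k} (h h′ : Vec (Poly n) k) (F : Fin k → Poly n) α →
    rawCoeff (linComb (zipWith _++_ h h′) F) α ≡ rawCoeff (linComb h F) α + rawCoeff (linComb h′ F) α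
  rawCoeff-linComb-++ V.[]      V.[]        F α = refl
  rawCoeff-linComb-++ (P V.∷ h) (P′ V.∷ h′) F α = begin
    rawCoeff ((P ++ P′) *P F fzero ++ rest (zipWith _++_ h h′)) α
        ≡⟨ rawCoeff-++ ((P ++ P′) *P F fzero) (rest (zipWith _++_ h h′)) α ⟩
    rawCoeff ((P ++ P′) *P F fzero) α + rawCoeff (rest (zipWith _++_ h h′)) α
        ≡⟨ cong₂ _+_ (trans (cong (λ L → rawCoeff L α) (concatMap-++ _ P P′)) (rawCoeff-++ (P *P F fzero) (P′ *P F fzero) α))
                     (rawCoeff-linComb-++ h h′ (F ∘ fsuc) α) ⟩
    (rawCoeff (P *P F fzero) α + rawCoeff (P′ *P F fzero) α) + (rawCoeff (rest h) α + rawCoeff (rest h′) α)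
        ≡⟨ +-interchange (rawCoeff (P *P F fzero) α) _ _ _ ⟩
    (rawCoeff (P *P F fzero) α + rawCoeff (rest h) α) + (rawCoeff (P′ *P F fzero) α + rawCoeff (rest h′) α)
        ≡⟨ cong₂ _+_ (rawCoeff-++ (P *P F fzero) (rest h) α) (rawCoeff-++ (P′ *P F fzero) (rest h′) α) ⟨
    rawCoeff (P *P F fzero ++ rest h) α + rawCoeff (P′ *P F fzero ++ rest h′) α
        ∎
    where
    open ≡-Reasoning
    rest : Vec _ _ → Poly _
    rest g = linComb g (F ∘ fsuc)

  zipWith-+-zeroExp : ∀ {n} (γ : Exp n) → zipWith _+_ γ zeroExp ≡ γ
  zipWith-+-zeroExp V.[]      = refl
  zipWith-+-zeroExp (a V.∷ γ) = cong₂ V._∷_ (+-identityʳ a) (zipWith-+-zeroExp γ)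

  zipWith-+-unit : ∀ {n} (γ : Exp n) j c k → zipWith _+_ (γ [ j ]≔ c) (zeroExp [ j ]≔ k) ≡ γ [ j ]≔ (c + k)
  zipWith-+-unit (a V.∷ γ) fzero    c k = cong ((c + k) V.∷_) (zipWith-+-zeroExp γ)
  zipWith-+-unit (a V.∷ γ) (fsuc j) c k = cong₂ V._∷_ (+-identityʳ a) (zipWith-+-unit γ j c k)

  powerSumᵛ : ∀ {n} → ℕ → Exp n → ℕ
  powerSumᵛ p V.[]      = 1
  powerSumᵛ p (k V.∷ α) = powerSum p k * powerSumᵛ p α

  ∑-points : ∀ p {n} (α : Exp n) → ∑[ x ← points p n ] evalMono x α ≡ powerSumᵛ p α
  ∑-points p V.[]              = refl
  ∑-points p {suc n} (k V.∷ α) = begin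
    ∑ (concatMap (λ a → map (a V.∷_) (points p n)) (upTo p)) (λ x → evalMono x (k V.∷ α))
        ≡⟨ ∑-concatMap _ (upTo p) _ ⟩
    ∑[ a ← upTo p ] ∑ (map (a V.∷_) (points p n)) (λ x → evalMono x (k V.∷ α))
        ≡⟨ ∑-cong (upTo p) (λ a → trans (∑-map (a V.∷_) (points p n) _) (∑-*ˡ (points p n) (a ^ k) (λ x → evalMono x α))) ⟩
    ∑[ a ← upTo p ] (a ^ k * ∑[ x ← points p n ] evalMono x α)
        ≡⟨ ∑-*ʳ (upTo p) _ (λ a → a ^ k) ⟩
    powerSum p k * ∑[ x ← points p n ] evalMono x α
        ≡⟨ cong (powerSum p k *_) (∑-points p α) ⟩
    powerSum p k * powerSumᵛ p α
        ∎
    where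
    open ≡-Reasoning

  setAll : ∀ {n} → List (Fin n) → ℕ → Exp n → Exp n
  setAll []       c v = v
  setAll (j ∷ js) c v = setAll js c (v [ j ]≔ c)

  setAll-map-fsuc : ∀ {n} (js : List (Fin n)) c a (v : Exp n) → setAll (map fsuc js) c (a V.∷ v) ≡ a V.∷ setAll js c v
  setAll-map-fsuc []       c a v = refl
  setAll-map-fsuc (j ∷ js) c a v = setAll-map-fsuc js c a (v [ j ]≔ c)

  setAll-allFin : ∀ {n} c (v : Exp n) → setAll (allFin n) c v ≡ V.replicate n c
  setAll-allFin c V.[]                = refl
  setAll-allFin {suc n} c (a V.∷ v) = begin
    setAll (tabulateL fsuc) c (c V.∷ v)          ≡⟨ cong (λ js → setAll js c (c V.∷ v)) (map-tabulate id fsuc) ⟨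
    setAll (map fsuc (allFin n)) c (c V.∷ v)     ≡⟨ setAll-map-fsuc (allFin n) c c v ⟩
    c V.∷ setAll (allFin n) c v                  ≡⟨ cong (c V.∷_) (setAll-allFin c v) ⟩
    c V.∷ V.replicate n c                      ∎
    where
    open ≡-Reasoning

  All-[]≔ : ∀ {n} {P : ℕ → Set} {v : Vec ℕ n} → All P v → ∀ j {c} → P c → All P (v [ j ]≔ c)
  All-[]≔ (_  ∷ Pv) fzero    Pc = Pc ∷ Pv
  All-[]≔ (Pa ∷ Pv) (fsuc j) Pc = Pa ∷ All-[]≔ Pv j Pc

  module _ (p-1 : ℕ) where

    open Modulo p-1
    open import Relation.Binary.Reasoning.Setoid ≈-setoid

    PolyEq⇒rawCoeff≈ : ∀ {n} (P Q : Poly n) → PolyEq p P Q → ∀ α → rawCoeff P α ≈ rawCoeff Q α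
    PolyEq⇒rawCoeff≈ P Q P=Q α = mk≈ {rawCoeff P α} {rawCoeff Q α} (P=Q α)

    PolyEq⇒⟦⟧≈ : ∀ {n} (P Q : Poly n) → PolyEq p P Q → ∀ x → ⟦ P ⟧ x ≈ ⟦ Q ⟧ x
    PolyEq⇒⟦⟧≈ P Q P=Q x = begin
      ⟦ P ⟧ x                                  ≡⟨ ∑-rawCoeff-exponents x {P} ∈-++⁺ˡ ⟨
      ∑[ α ← D ] (rawCoeff P α * evalMono x α)  ≈⟨ ∑-cong-≈ D (λ α → *-cong (PolyEq⇒rawCoeff≈ P Q P=Q α) (≈-refl {evalMono x α})) ⟩
      ∑[ α ← D ] (rawCoeff Q α * evalMono x α)  ≡⟨ ∑-rawCoeff-exponents x {Q} (∈-++⁺ʳ P) ⟩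
      ⟦ Q ⟧ x                                  ∎
      where D = exponents (P ++ Q)

    ∑-monicExpansion : ∀ {n} (P : Poly n) x → ∑ (monicExpansion p P) (evalMono x) ≈ ⟦ P ⟧ x
    ∑-monicExpansion P x = begin
      ∑ (monicExpansion p P) (evalMono x)                      ≡⟨ ∑-concatMap _ (exponents P) (evalMono x) ⟩
      ∑[ α ← exponents P ] ∑ (replicate (coeff p P α) α) (evalMono x)
                                                               ≡⟨ ∑-cong (exponents P) (λ α → ∑-replicate (coeff p P α) α (evalMono x)) ⟩
      ∑[ α ← exponents P ] (coeff p P α * evalMono x α)        ≈⟨ ∑-cong-≈ (exponents P) (λ α → *-cong (%-≈ (rawCoeff P α)) (≈-refl {evalMono x α})) ⟩
      ∑[ α ← exponents P ] (rawCoeff P α * evalMono x α)       ≡⟨ ∑-rawCoeff-exponents x {P} id ⟩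
      ⟦ P ⟧ x                                                  ∎

    ⟦linComb⟧≈0 : ∀ {n k} (x : Vec ℕ n) (h : Vec (Poly n) k) (F : Fin k → Poly n) →
                  (∀ j → ⟦ F j ⟧ x ≈ 0) → ⟦ linComb h F ⟧ x ≈ 0
    ⟦linComb⟧≈0 x V.[]      F F≈0 = ≈-refl
    ⟦linComb⟧≈0 x (P V.∷ h) F F≈0 = begin
      ⟦ P *P F fzero ++ linComb h (F ∘ fsuc) ⟧ x                ≡⟨ ⟦⟧-++ x (P *P F fzero) (linComb h (F ∘ fsuc)) ⟩
      ⟦ P *P F fzero ⟧ x + ⟦ linComb h (F ∘ fsuc) ⟧ x           ≡⟨ cong (_+ ⟦ linComb h (F ∘ fsuc) ⟧ x) (⟦⟧-*P x P (F fzero)) ⟩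
      ⟦ P ⟧ x * ⟦ F fzero ⟧ x + ⟦ linComb h (F ∘ fsuc) ⟧ x      ≈⟨ +-cong (*-cong (≈-refl {⟦ P ⟧ x}) (F≈0 fzero)) (⟦linComb⟧≈0 x h (F ∘ fsuc) (F≈0 ∘ fsuc)) ⟩
      ⟦ P ⟧ x * 0 + 0                                           ≡⟨ cong (_+ 0) (*-zeroʳ (⟦ P ⟧ x)) ⟩
      0                                                         ∎

    CongIdeal-refl : ∀ {n} (P : Poly n) → CongIdeal p P P
    CongIdeal-refl {n} P = V.replicate n [] , λ α → %-≡ (begin
      rawCoeff (minusP p P P) α                      ≡⟨ rawCoeff-minusP p P P α ⟩
      p * rawCoeff P α                               ≈⟨ p*≈0 (rawCoeff P α) ⟩
      0                                              ≡⟨ cong (λ L → rawCoeff L α) (linComb-zeros (fieldEq p)) ⟨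
      rawCoeff (linComb (V.replicate n []) (fieldEq p)) α  ∎)

    CongIdeal-trans : ∀ {n} {P Q R : Poly n} → CongIdeal p P Q → CongIdeal p Q R → CongIdeal p P R
    CongIdeal-trans {n} {P} {Q} {R} (h , P-Q=h) (h′ , Q-R=h′) = zipWith _++_ h h′ , λ α → %-≡ (begin
      rawCoeff (minusP p P R) α                                 ≡⟨ rawCoeff-minusP p P R α ⟩
      cP α + p-1 * cR α                                         ≈⟨ +-≈0ʳ (cP α + p-1 * cR α) (p*≈0 (cQ α)) ⟨
      (cP α + p-1 * cR α) + p * cQ α                            ≡⟨ regroup (cP α) (cQ α) (cR α) ⟩
      (cP α + p-1 * cQ α) + (cQ α + p-1 * cR α)                 ≡⟨ cong₂ _+_ (rawCoeff-minusP p P Q α) (rawCoeff-minusP p Q R α) ⟨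
      rawCoeff (minusP p P Q) α + rawCoeff (minusP p Q R) α     ≈⟨ +-cong (PolyEq⇒rawCoeff≈ (minusP p P Q) (linComb h (fieldEq p)) P-Q=h α)
                                                                         (PolyEq⇒rawCoeff≈ (minusP p Q R) (linComb h′ (fieldEq p)) Q-R=h′ α) ⟩
      rawCoeff (linComb h (fieldEq p)) α + rawCoeff (linComb h′ (fieldEq p)) α
                                                                ≡⟨ rawCoeff-linComb-++ h h′ (fieldEq p) α ⟨
      rawCoeff (linComb (zipWith _++_ h h′) (fieldEq p)) α      ∎)
      where
      cP cQ cR : Exp n → ℕ
      cP = rawCoeff P
      cQ = rawCoeff Q
      cR = rawCoeff R
      regroup : ∀ a b c → (a + p-1 * c) + p * b ≡ (a + p-1 * b) + (b + p-1 * c)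
      regroup a b c = solve 4 (λ a b c m → (a :+ m :* c) :+ (con 1 :+ m) :* b := (a :+ m :* b) :+ (b :+ m :* c)) refl a b c p-1
        where
        open +-*-Solver

    CongIdeal-step : ∀ {n} (γ : Exp n) j e → CongIdeal p (mono (γ [ j ]≔ (e + p))) (mono (γ [ j ]≔ (e + 1)))
    CongIdeal-step {n} γ j e = V.replicate n [] [ j ]≔ mono (γ [ j ]≔ e) , λ α → cong (λ L → coeff p L α) difference
      where
      difference : minusP p (mono (γ [ j ]≔ (e + p))) (mono (γ [ j ]≔ (e + 1))) ≡
                   linComb (V.replicate n [] [ j ]≔ mono (γ [ j ]≔ e)) (fieldEq p)
      difference = sym (trans (linComb-single j (mono (γ [ j ]≔ e)) (fieldEq p))
                              (cong₂ (λ a b → (1 , a) ∷ b ∷ []) (zipWith-+-unit γ j e p)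
                                     (cong₂ _,_ (*-identityˡ (p-1 * 1)) (zipWith-+-unit γ j e 1))))

    CongIdeal-reduce : ∀ {n} (γ : Exp n) j e i → CongIdeal p (mono (γ [ j ]≔ (suc e + i * p-1))) (mono (γ [ j ]≔ suc e))
    CongIdeal-reduce γ j e zero    = subst (λ k → CongIdeal p (mono (γ [ j ]≔ k)) (mono (γ [ j ]≔ suc e)))
                                           (sym (+-identityʳ (suc e))) (CongIdeal-refl (mono (γ [ j ]≔ suc e)))
    CongIdeal-reduce γ j e (suc i) = CongIdeal-trans {P = mono (γ [ j ]≔ (suc e + (p-1 + i * p-1)))} {mono (γ [ j ]≔ (suc e + i * p-1))} {mono (γ [ j ]≔ suc e)} (subst₂ (λ a b → CongIdeal p (mono (γ [ j ]≔ a)) (mono (γ [ j ]≔ b)))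
                                                            shift (+-comm f 1) (CongIdeal-step γ j f))
                                                    (CongIdeal-reduce γ j e i)
      where
      f = e + i * p-1
      shift : f + p ≡ suc e + (p-1 + i * p-1)
      shift = solve 3 (λ e i m → (e :+ i :* m) :+ (con 1 :+ m) := (con 1 :+ e) :+ (m :+ i :* m)) refl e i p-1
        where
        open +-*-Solver

  -- Counting zeros modulo p

  module Counting (r : ℕ) (p-prime : Prime (2 + r)) where

    open ModPrime r p-prime
    open import Relation.Binary.Reasoning.Setoid ≈-setoid

    ⟦fieldEq⟧≈0 : ∀ {n} (x : Vec ℕ n) j → ⟦ fieldEq p j ⟧ x ≈ 0
    ⟦fieldEq⟧≈0 x j = begin
      ⟦ fieldEq p j ⟧ x                                                   ≡⟨ ⟦⟧-minusP x p (mono (zeroExp [ j ]≔ p)) (mono (zeroExp [ j ]≔ 1)) ⟩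
      ⟦ mono (zeroExp [ j ]≔ p) ⟧ x + q * ⟦ mono (zeroExp [ j ]≔ 1) ⟧ x   ≡⟨ cong₂ (λ a b → a + q * b) (unit p) (unit 1) ⟩
      y ^ p + q * y ^ 1                                                   ≈⟨ +-cong (≈-trans (fermat y) (≡⇒≈ (sym (*-identityʳ y)))) (≈-refl {q * y ^ 1}) ⟩
      p * y ^ 1                                                           ≈⟨ p*≈0 (y ^ 1) ⟩
      0                                                                   ∎
      where
      y = V.lookup x j
      unit : ∀ k → ⟦ mono (zeroExp [ j ]≔ k) ⟧ x ≡ y ^ k
      unit k = trans (⟦⟧-mono x _) (evalMono-unit x j k)

    CongIdeal⇒⟦⟧≈ : ∀ {n} (P Q : Poly n) → CongIdeal p P Q → ∀ x → ⟦ P ⟧ x ≈ ⟦ Q ⟧ x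
    CongIdeal⇒⟦⟧≈ P Q (h , P-Q=h) x = begin
      ⟦ P ⟧ x                               ≈⟨ +-≈0ʳ (⟦ P ⟧ x) (p*≈0 (⟦ Q ⟧ x)) ⟨
      ⟦ P ⟧ x + p * ⟦ Q ⟧ x                 ≡⟨ x+[y+z]≡x+z+y (⟦ P ⟧ x) (⟦ Q ⟧ x) (q * ⟦ Q ⟧ x) ⟩
      (⟦ P ⟧ x + q * ⟦ Q ⟧ x) + ⟦ Q ⟧ x     ≡⟨ cong (_+ ⟦ Q ⟧ x) (⟦⟧-minusP x p P Q) ⟨
      ⟦ minusP p P Q ⟧ x + ⟦ Q ⟧ x          ≈⟨ +-cong P-Q≈0 (≈-refl {⟦ Q ⟧ x}) ⟩
      ⟦ Q ⟧ x                               ∎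
      where
      P-Q≈0 : ⟦ minusP p P Q ⟧ x ≈ 0
      P-Q≈0 = ≈-trans (PolyEq⇒⟦⟧≈ q (minusP p P Q) (linComb h (fieldEq p)) P-Q=h x) (⟦linComb⟧≈0 q x h (fieldEq p) (⟦fieldEq⟧≈0 x))

    powerSumᵛ-replicate-q : ∀ n → powerSumᵛ p (V.replicate n q) ≈ q ^ n
    powerSumᵛ-replicate-q zero    = ≈-refl
    powerSumᵛ-replicate-q (suc n) = *-cong S-q≈q (powerSumᵛ-replicate-q n)

    IsMaxDeg⇒powerSumᵛ≈ : ∀ {n} (t : Exp n) → IsMaxDeg p t → powerSumᵛ p t ≈ q ^ n
    IsMaxDeg⇒powerSumᵛ≈ {n} t t~M = begin
      powerSumᵛ p t                        ≡⟨ ∑-points p t ⟨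
      ∑[ x ← points p n ] evalMono x t     ≈⟨ ∑-cong-≈ (points p n) evalMono≈ ⟩
      ∑[ x ← points p n ] evalMono x M     ≡⟨ ∑-points p M ⟩
      powerSumᵛ p M                        ≈⟨ powerSumᵛ-replicate-q n ⟩
      q ^ n                                ∎
      where
      M = V.replicate n q
      evalMono≈ : ∀ x → evalMono x t ≈ evalMono x M
      evalMono≈ x = ≈-trans (≡⇒≈ (sym (⟦⟧-mono x t)))
                            (≈-trans (CongIdeal⇒⟦⟧≈ (mono t) (mono M) t~M x) (≡⇒≈ (⟦⟧-mono x M)))

    ∣⁺⇒CongIdeal : ∀ {n} (v : Exp n) j → q ∣⁺ V.lookup v j → CongIdeal p (mono v) (mono (v [ j ]≔ q))
    ∣⁺⇒CongIdeal v j (i , vⱼ≡qi+q) =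
      subst (λ w → CongIdeal p (mono w) (mono (v [ j ]≔ q))) v≡ (CongIdeal-reduce q v j r i)
      where
      v≡ : v [ j ]≔ (q + i * q) ≡ v
      v≡ = trans (cong (v [ j ]≔_) (sym (trans vⱼ≡qi+q (trans (*-suc q i) (cong (q +_) (*-comm q i)))))) ([]≔-lookup v j)

    saturate : ∀ {n} (js : List (Fin n)) (v : Exp n) → All (q ∣⁺_) v → CongIdeal p (mono v) (mono (setAll js q v))
    saturate []       v _  = CongIdeal-refl q (mono v)
    saturate (j ∷ js) v v∣ = CongIdeal-trans q {P = mono v} {mono (v [ j ]≔ q)} {mono (setAll js q (v [ j ]≔ q))}
      (∣⁺⇒CongIdeal v j (lookup⁺ v∣ j))
      (saturate js (v [ j ]≔ q) (All-[]≔ v∣ j (0 , sym (*-identityʳ q))))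

    All∣⁺⇒IsMaxDeg : ∀ {n} (t : Exp n) → All (q ∣⁺_) t → IsMaxDeg p t
    All∣⁺⇒IsMaxDeg {n} t t∣ = subst (λ w → CongIdeal p (mono t) (mono w)) (setAll-allFin q t) (saturate (allFin n) t t∣)

    All∣⁺⊎powerSumᵛ≈0 : ∀ {n} (t : Exp n) → All (q ∣⁺_) t ⊎ powerSumᵛ p t ≈ 0
    All∣⁺⊎powerSumᵛ≈0 V.[]      = inj₁ []
    All∣⁺⊎powerSumᵛ≈0 (k V.∷ t) with q∣⁺⊎S≈0 k | All∣⁺⊎powerSumᵛ≈0 t
    ... | inj₂ Sk≈0 | _         = inj₂ (*-cong Sk≈0 (≈-refl {powerSumᵛ p t}))
    ... | inj₁ q∣k  | inj₁ t∣   = inj₁ (q∣k ∷ t∣)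
    ... | inj₁ _    | inj₂ St≈0 = inj₂ (≈-trans (*-cong (≈-refl {S k}) St≈0) (≡⇒≈ (*-zeroʳ (S k))))

    powerSumᵛ≈ : ∀ {n} (d : Exp n → Bool) → (∀ t → (d t ≡ true) ⇔ IsMaxDeg p t) →
                 ∀ t → powerSumᵛ p t ≈ q ^ n * 𝟙 (d t)
    powerSumᵛ≈ {n} d d⇔ t with d t in dt≡
    ... | true  = ≈-trans (IsMaxDeg⇒powerSumᵛ≈ t (Equivalence.to (d⇔ t) dt≡)) (≡⇒≈ (sym (*-identityʳ (q ^ n))))
    ... | false with All∣⁺⊎powerSumᵛ≈0 t
    ...   | inj₂ St≈0 = ≈-trans St≈0 (≡⇒≈ (sym (*-zeroʳ (q ^ n))))
    ...   | inj₁ t∣   with () ← trans (sym dt≡) (Equivalence.from (d⇔ t) (All∣⁺⇒IsMaxDeg t t∣))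

    ⟦CW⟧≈𝟙 : ∀ {n} (f : Poly n) x → ⟦ CW p f ⟧ x ≈ 𝟙 (eval p f x ≡ᵇ 0)
    ⟦CW⟧≈𝟙 f x = ≈-trans (≡⇒≈ ⟦CW⟧≡) (indicator (⟦ f ⟧ x))
      where
      ⟦CW⟧≡ : ⟦ CW p f ⟧ x ≡ 1 + q * ⟦ f ⟧ x ^ q
      ⟦CW⟧≡ = trans (⟦⟧-minusP x p onePoly (f ^P q)) (cong₂ (λ a b → a + q * b) (⟦⟧-onePoly x) (⟦⟧-^P x f q))
      indicator : ∀ v → 1 + q * v ^ q ≈ 𝟙 (v % p ≡ᵇ 0)
      indicator v with v % p in v%p≡
      ... | zero  = +-≈0ʳ 1 (≈-trans (*-cong (≈-refl {q}) (^-cong q (mk≈ {v} {0} v%p≡))) (≡⇒≈ (*-zeroʳ q)))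
      ... | suc _ = ≈-trans (+-cong (≈-refl {1}) (*-cong (≈-refl {q}) (fermat-unit v≉0))) (≈-trans (≡⇒≈ (cong suc (*-identityʳ q))) p≈0)
        where
        v≉0 : ¬ v ≈ 0
        v≉0 (mk≈ v%p≡0) with () ← trans (sym v%p≡) v%p≡0

    ∑-tSs≈𝟙 : ∀ {n m} (fs : Vec (Poly n) m) x →
              ∑ (tSs p fs) (evalMono x) ≈ 𝟙 (and (map (λ f → eval p f x ≡ᵇ 0) (toList fs)))
    ∑-tSs≈𝟙 fs x = begin
      ∑ (map monProd (choices Es)) (evalMono x)                 ≡⟨ ∑-map monProd (choices Es) (evalMono x) ⟩
      ∑[ ts ← choices Es ] evalMono x (monProd ts)              ≡⟨ ∑-cong (choices Es) (evalMono-monProd x) ⟩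
      ∑[ ts ← choices Es ] ∏ ts (evalMono x)                    ≡⟨ ∑-choices Es (evalMono x) ⟩
      ∏[ E ← Es ] ∑ E (evalMono x)                              ≡⟨ cong product (map-∘ L) ⟨
      ∏[ f ← L ] ∑ (monicExpansion p (CW p f)) (evalMono x)     ≈⟨ ∏-cong-≈ L (λ f → ≈-trans (∑-monicExpansion q (CW p f) x) (⟦CW⟧≈𝟙 f x)) ⟩
      ∏[ f ← L ] 𝟙 (eval p f x ≡ᵇ 0)                            ≡⟨ 𝟙-and (λ f → eval p f x ≡ᵇ 0) L ⟨
      𝟙 (and (map (λ f → eval p f x ≡ᵇ 0) L))                   ∎
      where
      L = toList fs
      Es = map (λ f → monicExpansion p (CW p f)) L

    numZeros≈ : ∀ {n m} (fs : Vec (Poly n) m) → numZeros p fs ≈ ∑[ t ← tSs p fs ] powerSumᵛ p t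
    numZeros≈ {n} fs = begin
      numZeros p fs                                                      ≡⟨ length-filterᵇ _ (points p n) ⟩
      ∑[ x ← points p n ] 𝟙 (and (map (λ f → eval p f x ≡ᵇ 0) (toList fs)))
                                                                         ≈⟨ ∑-cong-≈ (points p n) (λ x → ≈-sym (∑-tSs≈𝟙 fs x)) ⟩
      ∑[ x ← points p n ] ∑ (tSs p fs) (evalMono x)                       ≡⟨ ∑-comm (points p n) (tSs p fs) evalMono ⟩
      ∑[ t ← tSs p fs ] (∑[ x ← points p n ] evalMono x t)               ≡⟨ ∑-cong (tSs p fs) (∑-points p) ⟩
      ∑[ t ← tSs p fs ] powerSumᵛ p t                                    ∎

    numZeros≈q^n*numMaxDeg : ∀ {n m} (fs : Vec (Poly n) m) (d : Exp n → Bool) → (∀ t → (d t ≡ true) ⇔ IsMaxDeg p t) →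
                             numZeros p fs ≈ q ^ n * numMaxDeg p d fs
    numZeros≈q^n*numMaxDeg {n} fs d d⇔ = begin
      numZeros p fs                                   ≈⟨ numZeros≈ fs ⟩
      ∑[ t ← tSs p fs ] powerSumᵛ p t                 ≈⟨ ∑-cong-≈ (tSs p fs) (powerSumᵛ≈ d d⇔) ⟩
      ∑[ t ← tSs p fs ] (q ^ n * 𝟙 (d t))             ≡⟨ ∑-*ˡ (tSs p fs) (q ^ n) (𝟙 ∘ d) ⟩
      q ^ n * ∑[ t ← tSs p fs ] 𝟙 (d t)               ≡⟨ cong (q ^ n *_) (length-filterᵇ d (tSs p fs)) ⟨
      q ^ n * numMaxDeg p d fs                        ∎

-- From ℕ modulo p to divisibility in ℤ

open import Data.Nat using (ℕ; zero; suc; _%_; _/_) renaming (_*_ to _*ℕ_; _^_ to _^ℕ_)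
open import Data.Nat.Properties using (+-comm)
open import Data.Nat.DivMod using (m≡m%n+[m/n]*n)
open import Data.Nat.Primality using (Prime)
open import Data.Integer using (+_; _+_; _-_; _*_; _^_; -1ℤ; 0ℤ)
open import Data.Integer.Properties using (pos-+; pos-*; *-zeroˡ)
open import Data.Integer.Divisibility using (_∣_)
open import Data.Integer.Divisibility.Signed using (divides; ∣⇒∣ᵤ; ∣-reflexive; ∣m∣n⇒∣m+n; ∣n⇒∣m*n; ∣m⇒∣m*n) renaming (_∣_ to _∣ˢ_)
open import Data.Integer.Solver using (module +-*-Solver)
open import Data.Bool using (Bool; true)
open import Data.Vec using (Vec)
open import Function.Bundles using (_⇔_)
open import Relation.Binary.PropositionalEquality
open ≡-Reasoning

pos-^ : ∀ m n → + (m ^ℕ n) ≡ (+ m) ^ n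
pos-^ m zero    = refl
pos-^ m (suc n) = trans (pos-* m (m ^ℕ n)) (cong ((+ m) *_) (pos-^ m n))

∣x-y⇒∣xⁿ-yⁿ : ∀ {k x y} n → k ∣ˢ x - y → k ∣ˢ x ^ n - y ^ n
∣x-y⇒∣xⁿ-yⁿ {k} zero    _     = divides 0ℤ (sym (*-zeroˡ k))
∣x-y⇒∣xⁿ-yⁿ {k} {x} {y} (suc n) k∣x-y = subst (k ∣ˢ_) telescope
  (∣m∣n⇒∣m+n (∣n⇒∣m*n x (∣x-y⇒∣xⁿ-yⁿ n k∣x-y)) (∣m⇒∣m*n (y ^ n) k∣x-y))
  where
  open +-*-Solver
  telescope : x * (x ^ n - y ^ n) + (x - y) * y ^ n ≡ x * x ^ n - y * y ^ n
  telescope = solve 4 (λ x y X Y → x :* (X :- Y) :+ (x :- y) :* Y := x :* X :- y :* Y) refl x y (x ^ n) (y ^ n)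

module _ (p-1 : ℕ) where

  open Modulo p-1

  ≈⇒p∣a-b : ∀ {a b} → a ≈ b → + p ∣ˢ + a - + b
  ≈⇒p∣a-b {a} {b} (mk≈ a%p≡b%p) = divides (+ (a / p) - + (b / p)) (begin
    + a - + b                                                       ≡⟨ cong₂ _-_ (divMod a) (divMod b) ⟩
    (+ (a % p) + + (a / p) * + p) - (+ (b % p) + + (b / p) * + p)   ≡⟨ cong (λ c → (+ (a % p) + + (a / p) * + p) - (+ c + + (b / p) * + p)) a%p≡b%p ⟨
    (+ (a % p) + + (a / p) * + p) - (+ (a % p) + + (b / p) * + p)   ≡⟨ solve 4 (λ c A B P → (c :+ A :* P) :- (c :+ B :* P) := (A :- B) :* P) refl
                                                                               (+ (a % p)) (+ (a / p)) (+ (b / p)) (+ p) ⟩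
    (+ (a / p) - + (b / p)) * + p                                   ∎)
    where
    open +-*-Solver
    divMod : ∀ c → + c ≡ + (c % p) + + (c / p) * + p
    divMod c = trans (cong +_ (m≡m%n+[m/n]*n c p)) (trans (pos-+ (c % p) (c / p *ℕ p)) (cong (_+_ (+ (c % p))) (pos-* (c / p) p)))

  ≈[p-1]ⁿ*⇒p∣-[-1]ⁿ* : ∀ n {N K} → N ≈ p-1 ^ℕ n *ℕ K → + p ∣ˢ + N - -1ℤ ^ n * + K
  ≈[p-1]ⁿ*⇒p∣-[-1]ⁿ* n {N} {K} N≈ = subst (+ p ∣ˢ_) split
    (∣m∣n⇒∣m+n (≈⇒p∣a-b N≈) (∣m⇒∣m*n (+ K) (∣x-y⇒∣xⁿ-yⁿ n (∣-reflexive (cong +_ (+-comm 1 p-1))))))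
    where
    open +-*-Solver
    split : (+ N - + (p-1 ^ℕ n *ℕ K)) + ((+ p-1) ^ n - -1ℤ ^ n) * + K ≡ + N - -1ℤ ^ n * + K
    split = begin
      (+ N - + (p-1 ^ℕ n *ℕ K)) + ((+ p-1) ^ n - -1ℤ ^ n) * + K   ≡⟨ cong (λ z → (+ N - z) + ((+ p-1) ^ n - -1ℤ ^ n) * + K)
                                                                             (trans (pos-* (p-1 ^ℕ n) K) (cong (_* + K) (pos-^ p-1 n))) ⟩
      (+ N - (+ p-1) ^ n * + K) + ((+ p-1) ^ n - -1ℤ ^ n) * + K     ≡⟨ solve 4 (λ N Q S K → (N :- Q :* K) :+ (Q :- S) :* K := N :- S :* K) refl
                                                                             (+ N) ((+ p-1) ^ n) (-1ℤ ^ n) (+ K) ⟩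
      + N - -1ℤ ^ n * + K                                           ∎

lemma4p2 : (p : ℕ) → Prime p → (n m : ℕ) → (f : Vec (Poly n) m) →
    (d : Exp n → Bool) → (∀ t → (d t ≡ true) ⇔ IsMaxDeg p t) →
    (+ p) ∣ ((+ numZeros p f) - (-1ℤ ^ n) * (+ numMaxDeg p d f))
lemma4p2 0 ()
lemma4p2 1 ()
lemma4p2 (suc (suc r)) p-prime n m f d d⇔ =
  ∣⇒∣ᵤ (≈[p-1]ⁿ*⇒p∣-[-1]ⁿ* (suc r) n (numZeros≈q^n*numMaxDeg f d d⇔))
  where
  open Counting r p-prime using (numZeros≈q^n*numMaxDeg)
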